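{- Let $n\ge1$, let $\pi=\ddot\psi\backslash x_0\cdots x_n$ with $x_i\in\{\mathtt q,\mathtt s\}$, let $k\in\{0,\dots,n-1\}$, and let $W=dadaaaadaaaaddddaaaa$. Then: if $x_k=\mathtt q$, $f_\pi(0\backslash k,W)=0\backslash(k+1)$; otherwise $f_\pi(0\backslash k,W)\ge1\backslash(k+1)$; and unconditionally $f_\pi(1\backslash k,W)\ge1\backslash(k+1)$.
   Context: For $\psi\in\{\mathtt q,\mathtt s\}^N$ indexed from $0$, $\Pi(\psi)$ is the DFA over $\{a,d\}$ with states $\{0,\dots,N\}$, start $0$, accepting $\{0,\dots,N-1\}$, transition from $k<N$ on $c$ to $k+[\psi(k)=\mathtt q,c=d]+[\psi(k)=\mathtt s,c=a]$, state $N$ absorbing; $f_\pi(k,W)$ is the state reached from $k$ after reading $W$. Let $\ddot\psi=\mathtt{qqqqss}$; for $A=x_0\cdots x_{L-1}$, $\ddot\psi\backslash A$ is the chain $\Pi(B_0\cdots B_{L-1})$ with $B_k=\mathtt{qqqqss}$ if $x_k=\mathtt q$, $B_k=\mathtt{qqssss}$ if $x_k=\mathtt s$. For $0\le b\le5$, $b\backslash k$ denotes state $b+6k$. -}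

module Defs where

open import Data.Nat using (ℕ; zero; suc; _+_; _*_)
open import Data.List using (List; []; _∷_; concatMap)
open import Data.Vec using (Vec; toList)

data QS : Set where
  q s : QS

data Letter : Set where
  a d : Letter

-- A chain ψ ∈ {q,s}^N is a list of length N.
-- The DFA Π(ψ) has states 0..N (represented in ℕ); state N = length ψ is absorbing.
-- One transition from state k on letter c.
step : List QS → ℕ → Letter → ℕ
step []       k       c = k
step (q ∷ ψ)  zero    a = zero
step (q ∷ ψ)  zero    d = suc zero
step (s ∷ ψ)  zero    a = suc zero
step (s ∷ ψ)  zero    d = zero
step (_ ∷ ψ)  (suc k) c = suc (step ψ k c)

run : List QS → ℕ → List Letter → ℕ
run ψ k []       = k
run ψ k (c ∷ W)  = run ψ (step ψ k c) W

block : QS → List QS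
block q = q ∷ q ∷ q ∷ q ∷ s ∷ s ∷ []
block s = q ∷ q ∷ s ∷ s ∷ s ∷ s ∷ []

-- ψ̈ \ A : the chain B_0 ⋯ B_{L-1}
substChain : List QS → List QS
substChain A = concatMap block A

_⧹_ : ℕ → ℕ → ℕ
b ⧹ k = b + 6 * k

W16 : List Letter
W16 = d ∷ a ∷ d ∷ a ∷ a ∷ a ∷ a ∷ d ∷ a ∷ a ∷ a ∷ a ∷ d ∷ d ∷ d ∷ d ∷ a ∷ a ∷ a ∷ a ∷ []

-- The chain of ψ̈ \ A is the concatenation of the blocks B_k, and the
-- transition of a state depends only on the symbol at that state, so a run that
-- starts inside block k behaves exactly like the same run started in block 0 of
-- the chain B_k B_{k+1} ⋯, shifted by 6k states. It therefore suffices to read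
-- W from the first two states of a chain B_k B_{k+1} ⋯ and to compare the result
-- with state 6 = 0 \ 1 and state 7 = 1 \ 1; since no run ever moves backwards,
-- for the lower bounds it is enough to reach state 7 on a prefix of W.
module Submission where

open import Defs
open import Data.Nat using (ℕ; zero; suc; _≤_; _<_; _+_; _*_; z≤n; s≤s; s<s⁻¹)
open import Data.Nat.Properties
  using (m<n⇒m<1+n; ≤-refl; ≤-trans; +-monoʳ-≤; module ≤-Reasoning;
         +-comm; +-assoc; *-suc; *-distribˡ-+)
open import Data.Vec using (Vec; lookup; toList; _∷_)
open import Data.Fin using (fromℕ<)
open import Data.List using (List; []; _∷_; _++_; length; take)
open import Data.List.Properties using (concatMap-++)
open import Data.Product using (_×_; _,_; ∃-syntax)
open import Relation.Binary.PropositionalEquality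
  using (_≡_; refl; sym; trans; cong; cong₂; module ≡-Reasoning)

≤-step : ∀ ψ k c → k ≤ step ψ k c
≤-step []      k       c = ≤-refl
≤-step (q ∷ ψ) zero    a = z≤n
≤-step (q ∷ ψ) zero    d = z≤n
≤-step (s ∷ ψ) zero    a = z≤n
≤-step (s ∷ ψ) zero    d = z≤n
≤-step (q ∷ ψ) (suc k) c = s≤s (≤-step ψ k c)
≤-step (s ∷ ψ) (suc k) c = s≤s (≤-step ψ k c)

≤-run : ∀ ψ k w → k ≤ run ψ k w
≤-run ψ k []      = ≤-refl
≤-run ψ k (c ∷ w) = ≤-trans (≤-step ψ k c) (≤-run ψ (step ψ k c) w)

run-take-≤ : ∀ ψ k i w → run ψ k (take i w) ≤ run ψ k w
run-take-≤ ψ k zero    w       = ≤-run ψ k w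
run-take-≤ ψ k (suc i) []      = ≤-refl
run-take-≤ ψ k (suc i) (c ∷ w) = run-take-≤ ψ (step ψ k c) i w

step-++ : ∀ p ψ k c → step (p ++ ψ) (length p + k) c ≡ length p + step ψ k c
step-++ []      ψ k c = refl
step-++ (q ∷ p) ψ k c = cong suc (step-++ p ψ k c)
step-++ (s ∷ p) ψ k c = cong suc (step-++ p ψ k c)

run-++ : ∀ p ψ k w → run (p ++ ψ) (length p + k) w ≡ length p + run ψ k w
run-++ p ψ k []      = refl
run-++ p ψ k (c ∷ w) = trans (cong (λ i → run (p ++ ψ) i w) (step-++ p ψ k c))
                             (run-++ p ψ (step ψ k c) w)

length-substChain : ∀ A → length (substChain A) ≡ 6 * length A
length-substChain []      = refl
length-substChain (q ∷ A) = trans (cong (6 +_) (length-substChain A)) (sym (*-suc 6 (length A)))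
length-substChain (s ∷ A) = trans (cong (6 +_) (length-substChain A)) (sym (*-suc 6 (length A)))

⧹-+ : ∀ b j k → 6 * k + b ⧹ j ≡ b ⧹ (j + k)
⧹-+ b j k = begin
  6 * k + (b + 6 * j)   ≡⟨ +-comm (6 * k) (b + 6 * j) ⟩
  b + 6 * j + 6 * k     ≡⟨ +-assoc b (6 * j) (6 * k) ⟩
  b + (6 * j + 6 * k)   ≡⟨ cong (b +_) (*-distribˡ-+ 6 j k) ⟨
  b + 6 * (j + k)       ∎
  where open ≡-Reasoning

run-substChain-++ : ∀ A B b w →
  run (substChain (A ++ B)) (b ⧹ length A) w ≡ 6 * length A + run (substChain B) b w
run-substChain-++ A B b w = begin
  run (substChain (A ++ B)) (b + 6 * length A) w
    ≡⟨ cong (λ ψ → run ψ (b + 6 * length A) w) (concatMap-++ block A B) ⟩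
  run (substChain A ++ substChain B) (b + 6 * length A) w
    ≡⟨ cong (λ i → run (substChain A ++ substChain B) i w) b+6|A|≡|A′|+b ⟩
  run (substChain A ++ substChain B) (length (substChain A) + b) w
    ≡⟨ run-++ (substChain A) (substChain B) b w ⟩
  length (substChain A) + run (substChain B) b w
    ≡⟨ cong (_+ run (substChain B) b w) (length-substChain A) ⟩
  6 * length A + run (substChain B) b w ∎
  where
  open ≡-Reasoning
  b+6|A|≡|A′|+b : b + 6 * length A ≡ length (substChain A) + b
  b+6|A|≡|A′|+b = trans (+-comm b _) (cong (_+ b) (sym (length-substChain A)))

toList-split-at : ∀ {ℓ} {X : Set ℓ} {n} (x : Vec X (suc n)) {k} (k<n : k < n) →
  ∃[ p ] ∃[ z ] ∃[ A ] toList x ≡ p ++ lookup x (fromℕ< (m<n⇒m<1+n k<n)) ∷ z ∷ A × length p ≡ k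
toList-split-at (y ∷ z ∷ x) {zero} _ = [] , z , toList x , refl , refl
toList-split-at {n = suc _} (y ∷ x) {suc k} k<n with toList-split-at x (s<s⁻¹ k<n)
... | p , z , A , x≡ , |p|≡k = y ∷ p , z , A , cong (y ∷_) x≡ , cong suc |p|≡k

run-W16-from-q-block : ∀ {y} z A → y ≡ q → run (substChain (y ∷ z ∷ A)) (0 ⧹ 0) W16 ≡ 0 ⧹ 1
run-W16-from-q-block q A refl = refl
run-W16-from-q-block s A refl = refl

-- W reaches state 7 = 1 \ 1 within its first 8 letters, or 13 letters when
-- starting from state 1 of a q-block.
run-W16-from-s-block : ∀ {y} z A → y ≡ s → 1 ⧹ 1 ≤ run (substChain (y ∷ z ∷ A)) (0 ⧹ 0) W16
run-W16-from-s-block q A refl = run-take-≤ (substChain (s ∷ q ∷ A)) 0 8 W16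
run-W16-from-s-block s A refl = run-take-≤ (substChain (s ∷ s ∷ A)) 0 8 W16

run-W16-from-state-1 : ∀ y z A → 1 ⧹ 1 ≤ run (substChain (y ∷ z ∷ A)) (1 ⧹ 0) W16
run-W16-from-state-1 q q A = run-take-≤ (substChain (q ∷ q ∷ A)) 1 13 W16
run-W16-from-state-1 q s A = run-take-≤ (substChain (q ∷ s ∷ A)) 1 13 W16
run-W16-from-state-1 s q A = run-take-≤ (substChain (s ∷ q ∷ A)) 1 8 W16
run-W16-from-state-1 s s A = run-take-≤ (substChain (s ∷ s ∷ A)) 1 8 W16

lemma16 : (n : ℕ) → 1 ≤ n → (x : Vec QS (suc n)) → (k : ℕ) → (k<n : k < n) →
    ((lookup x (fromℕ< (m<n⇒m<1+n k<n)) ≡ q →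
        run (substChain (toList x)) (0 ⧹ k) W16 ≡ 0 ⧹ suc k)
     × (lookup x (fromℕ< (m<n⇒m<1+n k<n)) ≡ s →
        1 ⧹ suc k ≤ run (substChain (toList x)) (0 ⧹ k) W16)
     × (1 ⧹ suc k ≤ run (substChain (toList x)) (1 ⧹ k) W16))
lemma16 n _ x k k<n with toList-split-at x k<n
... | p , z , A , x≡ , refl rewrite x≡ =
    (λ y≡q → begin-equality
       run ψ (0 ⧹ k) W16           ≡⟨ shift 0 ⟩
       6 * k + run ψₖ 0 W16        ≡⟨ cong (6 * k +_) (run-W16-from-q-block z A y≡q) ⟩
       6 * k + 0 ⧹ 1               ≡⟨ ⧹-+ 0 1 k ⟩
       0 ⧹ suc k                   ∎)
  , (λ y≡s → shift-≤ 0 (run-W16-from-s-block z A y≡s))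
  , shift-≤ 1 (run-W16-from-state-1 y z A)
  where
  open ≤-Reasoning
  y : QS
  y = lookup x (fromℕ< (m<n⇒m<1+n k<n))
  ψ ψₖ : List QS
  ψ = substChain (p ++ y ∷ z ∷ A)
  ψₖ = substChain (y ∷ z ∷ A)

  shift : ∀ b → run ψ (b ⧹ k) W16 ≡ 6 * k + run ψₖ b W16
  shift b = run-substChain-++ p (y ∷ z ∷ A) b W16

  shift-≤ : ∀ b → 1 ⧹ 1 ≤ run ψₖ b W16 → 1 ⧹ suc k ≤ run ψ (b ⧹ k) W16
  shift-≤ b 7≤ = begin
    1 ⧹ suc k            ≡⟨ ⧹-+ 1 1 k ⟨
    6 * k + 1 ⧹ 1        ≤⟨ +-monoʳ-≤ (6 * k) 7≤ ⟩
    6 * k + run ψₖ b W16 ≡⟨ shift b ⟨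
    run ψ (b ⧹ k) W16    ∎
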